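{- Suppose that the sets $X$ and $Y$ form a partition of the nonnegative integers, let $(x(n))_{n\ge0}$ be the increasing enumeration of the elements of $X$ and $(y(n))_{n\ge0}$ the increasing enumeration of the elements of $Y$, and suppose that for all $n\ge0$: $x(x(n))=2x(n)$, $y(y(n))=2y(n)$, and $|x(n)-y(n)|=1$. Then either $x=a$ and $y=b$, or $x=b$ and $y=a$, where $(a(n))_{n\ge0}$ and $(b(n))_{n\ge0}$ are the increasing enumerations (indexed from $0$) of the odious numbers (nonnegative integers with odd binary digit sum) and of the evil numbers (nonnegative integers with even binary digit sum), respectively. In particular the sequence $(x(n)-y(n))_{n\ge0}$ equals $(1-2t(n))_{n\ge0}$ or $(2t(n)-1)_{n\ge0}$, where $t$ is the Thue–Morse sequence ($t(0)=0$, $t(2n)=t(n)$, $t(2n+1)=1-t(n)$).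
   Context: Here both $X$ and $Y$ are infinite (they are enumerated by sequences indexed by all $n\ge0$); "increasing" means strictly increasing. -}

module Defs where

open import Data.Nat using (ℕ; zero; suc; _+_; _*_; _<_; _%_; _/_; ∣_-_∣)
open import Data.Integer as ℤ using (ℤ; +_)
open import Data.Product using (∃; _×_)
open import Data.Sum using (_⊎_)
open import Relation.Binary.PropositionalEquality using (_≡_; _≢_)

-- binary digit sum, computed with fuel (fuel n suffices for n, since n / 2 < n for n > 0)
bitsumFuel : ℕ → ℕ → ℕ
bitsumFuel zero    n = 0
bitsumFuel (suc f) n = n % 2 + bitsumFuel f (n / 2)

bitsum : ℕ → ℕ
bitsum n = bitsumFuel n n

Odious : ℕ → Set
Odious n = bitsum n % 2 ≡ 1

Evil : ℕ → Set
Evil n = bitsum n % 2 ≡ 0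

thueMorse : ℕ → ℕ
thueMorse n = bitsum n % 2

StrictlyIncreasing : (ℕ → ℕ) → Set
StrictlyIncreasing f = ∀ m n → m < n → f m < f n

IsIncreasingEnumeration : (ℕ → ℕ) → (ℕ → Set) → Set
IsIncreasingEnumeration f P =
  StrictlyIncreasing f × (∀ m → (∃ λ n → f n ≡ m) → P m) × (∀ m → P m → ∃ λ n → f n ≡ m)

RangesPartitionℕ : (ℕ → ℕ) → (ℕ → ℕ) → Set
RangesPartitionℕ x y =
  (∀ m → (∃ λ n → x n ≡ m) ⊎ (∃ λ n → y n ≡ m)) × (∀ n k → x n ≢ y k)

{-# OPTIONS --safe #-}
-- By strong induction, x n and y n are 2n and 2n + 1 in some order: every value below 2n is
-- already taken at an earlier index, 2n can only be taken at index n, and the gap condition puts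
-- the partner at 2n + 1.  Say x 0 = 0 (otherwise swap x and y).  As t (2m) = t m and
-- t (2m + 1) = 1 - t m, the relations x (x q) = 2 x q and y (y q) = 2 y q carry "x q is evil and
-- y q is odious" over to the indices x q and y q, which together exhaust the positive integers.
-- Hence x and y enumerate the evil and the odious numbers, and x n - y n is read off from
-- t n = t (2n).
module Submission where

open import Defs
open import Data.Nat using (ℕ; zero; suc; _+_; _*_; _∸_; _≤_; _<_; z≤n; s≤s; z<s; ∣_-_∣; _%_; _/_)
open import Data.Nat.Properties
open import Data.Nat.DivMod
  using (%-remove-+ʳ; m<n⇒m%n≡m; +-distrib-/-∣ʳ; m<n⇒m/n≡0; /-congˡ; m*n/n≡m; %-distribˡ-+; m/n<m)
open import Data.Nat.Divisibility using (m∣m*n)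
open import Data.Nat.Induction using (<-rec)
open import Data.Integer as ℤ using (ℤ; +_; _-_; -_)
open import Data.Integer.Properties using ([+m]-[+n]≡m⊖n; ⊖-<; ⊖-≥; +-0-abelianGroup)
open import Algebra.Properties.AbelianGroup +-0-abelianGroup using (⁻¹-anti-homo‿-)
open import Data.Product using (_×_; _,_; ∃; proj₁; proj₂)
open import Data.Sum using (_⊎_; inj₁; inj₂; [_,_]′; swap)
open import Data.Empty using (⊥-elim)
open import Function using (_∘_)
open import Relation.Nullary using (¬_)
open import Relation.Binary using (tri<; tri≈; tri>)
open import Relation.Binary.PropositionalEquality
open ≡-Reasoning

bitsumFuel-zero : ∀ fuel → bitsumFuel fuel 0 ≡ 0
bitsumFuel-zero zero       = refl
bitsumFuel-zero (suc fuel) = bitsumFuel-zero fuel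

n≤1+f⇒n/2≤f : ∀ {n f} → n ≤ suc f → n / 2 ≤ f
n≤1+f⇒n/2≤f {zero}  _         = z≤n
n≤1+f⇒n/2≤f {suc n} (s≤s n≤f) = ≤-trans (≤-pred (m/n<m (suc n) 2 (s≤s (s≤s z≤n)))) n≤f

bitsumFuel-irrelevant : ∀ {f g n} → n ≤ f → n ≤ g → bitsumFuel f n ≡ bitsumFuel g n
bitsumFuel-irrelevant {zero}  {zero}  _   _   = refl
bitsumFuel-irrelevant {zero}  {suc g} z≤n _   = sym (bitsumFuel-zero (suc g))
bitsumFuel-irrelevant {suc f} {zero}  _   z≤n = bitsumFuel-zero (suc f)
bitsumFuel-irrelevant {suc f} {suc g} {n} n≤f n≤g =
  cong (_+_ (n % 2)) (bitsumFuel-irrelevant (n≤1+f⇒n/2≤f n≤f) (n≤1+f⇒n/2≤f n≤g))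

[r+2q]%2≡r : ∀ {r} q → r < 2 → (r + 2 * q) % 2 ≡ r
[r+2q]%2≡r {r} q r<2 = trans (%-remove-+ʳ r (m∣m*n q)) (m<n⇒m%n≡m r<2)

[r+2q]/2≡q : ∀ {r} q → r < 2 → (r + 2 * q) / 2 ≡ q
[r+2q]/2≡q {r} q r<2 = begin
  (r + 2 * q) / 2    ≡⟨ +-distrib-/-∣ʳ r (m∣m*n q) ⟩
  r / 2 + 2 * q / 2  ≡⟨ cong₂ _+_ (m<n⇒m/n≡0 r<2) (/-congˡ (*-comm 2 q)) ⟩
  q * 2 / 2          ≡⟨ m*n/n≡m q 2 ⟩
  q                  ∎

bitsum-digit : ∀ {r} q → r < 2 → bitsum (r + 2 * q) ≡ r + bitsum q
bitsum-digit {r} q r<2 = begin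
  bitsumFuel v v                ≡⟨ bitsumFuel-irrelevant ≤-refl (n≤1+n v) ⟩
  v % 2 + bitsumFuel v (v / 2)  ≡⟨ cong₂ _+_ ([r+2q]%2≡r q r<2) (cong (bitsumFuel v) ([r+2q]/2≡q q r<2)) ⟩
  r + bitsumFuel v q            ≡⟨ cong (_+_ r) (bitsumFuel-irrelevant q≤v ≤-refl) ⟩
  r + bitsum q                  ∎
  where
  v = r + 2 * q
  q≤v : q ≤ v
  q≤v = ≤-trans (m≤m+n q (q + 0)) (m≤n+m (2 * q) r)

thueMorse-double : ∀ n → thueMorse (2 * n) ≡ thueMorse n
thueMorse-double n = cong (_% 2) (bitsum-digit n z<s)

thueMorse-suc-double : ∀ n → thueMorse (suc (2 * n)) ≡ (1 + thueMorse n) % 2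
thueMorse-suc-double n = trans (cong (_% 2) (bitsum-digit n ≤-refl)) (%-distribˡ-+ 1 (bitsum n) 2)

Evil⇒Odious-suc-double : ∀ n → Evil n → Odious (suc (2 * n))
Evil⇒Odious-suc-double n evil = trans (thueMorse-suc-double n) (cong (λ t → (1 + t) % 2) evil)

Odious⇒Evil-suc-double : ∀ n → Odious n → Evil (suc (2 * n))
Odious⇒Evil-suc-double n odious = trans (thueMorse-suc-double n) (cong (λ t → (1 + t) % 2) odious)

Evil⇒¬Odious : ∀ n → Evil n → ¬ Odious n
Evil⇒¬Odious _ evil odious = 0≢1+n (trans (sym evil) odious)

data Halves (q : ℕ) : ℕ → Set where
  even : Halves q (2 * q)
  odd  : Halves q (suc (2 * q))

halve : ∀ v → ∃ λ q → Halves q v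
halve zero = 0 , even
halve (suc v) with halve v
... | q , even = q , odd
... | q , odd  = suc q , subst (Halves (suc q)) (*-suc 2 q) even

Halves⇒2*q≤v : ∀ {q v} → Halves q v → 2 * q ≤ v
Halves⇒2*q≤v even = ≤-refl
Halves⇒2*q≤v odd  = n≤1+n _

Halves⇒v≤1+2*q : ∀ {q v} → Halves q v → v ≤ suc (2 * q)
Halves⇒v≤1+2*q even = n≤1+n _
Halves⇒v≤1+2*q odd  = ≤-refl

data PairedAt (f g : ℕ → ℕ) (n : ℕ) : Set where
  even-odd : f n ≡ 2 * n → g n ≡ suc (2 * n) → PairedAt f g n
  odd-even : g n ≡ 2 * n → f n ≡ suc (2 * n) → PairedAt f g n

PairedAt-swap : ∀ {f g n} → PairedAt f g n → PairedAt g f n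
PairedAt-swap (even-odd fn≡2n gn≡1+2n) = odd-even fn≡2n gn≡1+2n
PairedAt-swap (odd-even gn≡2n fn≡1+2n) = even-odd gn≡2n fn≡1+2n

PairedAt⇒Halves : ∀ {f g n} → PairedAt f g n → Halves n (f n)
PairedAt⇒Halves (even-odd fn≡2n _)   = subst (Halves _) (sym fn≡2n) even
PairedAt⇒Halves (odd-even _ fn≡1+2n) = subst (Halves _) (sym fn≡1+2n) odd

PairedAt-covers : ∀ {f g q v} → PairedAt f g q → Halves q v → v ≡ f q ⊎ v ≡ g q
PairedAt-covers (even-odd fq≡2q _)   even = inj₁ (sym fq≡2q)
PairedAt-covers (even-odd _ gq≡1+2q) odd  = inj₂ (sym gq≡1+2q)
PairedAt-covers (odd-even gq≡2q _)   even = inj₂ (sym gq≡2q)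
PairedAt-covers (odd-even _ fq≡1+2q) odd  = inj₁ (sym fq≡1+2q)

PairedAt-partner : ∀ {f g n} → PairedAt f g n → f n ≡ 2 * n → g n ≡ suc (2 * n)
PairedAt-partner (even-odd _ gn≡1+2n) _     = gn≡1+2n
PairedAt-partner (odd-even _ fn≡1+2n) fn≡2n = ⊥-elim (1+n≢n (trans (sym fn≡1+2n) fn≡2n))

index<value : ∀ {h k : ℕ → ℕ} {q m} → PairedAt h k q → h q ≡ suc m → q < suc m
index<value {q = q} {m} paired-q hq≡1+m =
  *-cancelˡ-< 2 q (suc m) (≤-<-trans 2q≤1+m (m<m+n (suc m) z<s))
  where
  2q≤1+m : 2 * q ≤ suc m
  2q≤1+m = subst (2 * q ≤_) hq≡1+m (Halves⇒2*q≤v (PairedAt⇒Halves paired-q))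

m≤n⇒∣m-n∣≡1⇒n≡1+m : ∀ {m n} → m ≤ n → ∣ m - n ∣ ≡ 1 → n ≡ suc m
m≤n⇒∣m-n∣≡1⇒n≡1+m {m} {n} m≤n gap = begin
  n          ≡⟨ m∸n+n≡m m≤n ⟨
  n ∸ m + m  ≡⟨ cong (_+ m) (trans (sym (m≤n⇒∣m-n∣≡n∸m m≤n)) gap) ⟩
  suc m      ∎

RangesPartitionℕ-swap : ∀ {f g} → RangesPartitionℕ f g → RangesPartitionℕ g f
RangesPartitionℕ-swap (cover , disjoint) = swap ∘ cover , λ m k → disjoint k m ∘ sym

module _ {f g : ℕ → ℕ} (f-inc : StrictlyIncreasing f) {n : ℕ}
         (earlier : ∀ {k} → k < n → PairedAt f g k) where

  2*n≤f[n] : (∀ m k → f m ≢ g k) → 2 * n ≤ f n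
  2*n≤f[n] disjoint = ≮⇒≥ λ fn<2n →
    let q , q-halves = halve (f n)
        q<n = *-cancelˡ-< 2 q n (≤-<-trans (Halves⇒2*q≤v q-halves) fn<2n)
    in [ (λ fn≡fq → <-irrefl (sym fn≡fq) (f-inc q n q<n)) , disjoint n q ]′
         (PairedAt-covers (earlier q<n) q-halves)

  index-of-2*n : ∀ {m} → 2 * n ≤ f n → f m ≡ 2 * n → m ≡ n
  index-of-2*n {m} 2n≤fn fm≡2n with <-cmp m n
  ... | tri< m<n _ _ = ⊥-elim (<-irrefl fm≡2n (≤-<-trans fm≤1+2m 1+2m<2n))
    where
    fm≤1+2m : f m ≤ suc (2 * m)
    fm≤1+2m = Halves⇒v≤1+2*q (PairedAt⇒Halves (earlier m<n))
    1+2m<2n : suc (2 * m) < 2 * n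
    1+2m<2n = subst (_≤ 2 * n) (*-suc 2 m) (*-monoʳ-≤ 2 m<n)
  ... | tri≈ _ m≡n _ = m≡n
  ... | tri> _ _ n<m = ⊥-elim (<⇒≱ (f-inc n m n<m) (subst (_≤ f n) (sym fm≡2n) 2n≤fn))

  value-2*n⇒even-odd : ∀ {m} → 2 * n ≤ f n → 2 * n ≤ g n → ∣ f n - g n ∣ ≡ 1 → f m ≡ 2 * n →
                       PairedAt f g n
  value-2*n⇒even-odd 2n≤fn 2n≤gn gap fm≡2n =
    even-odd fn≡2n (m≤n⇒∣m-n∣≡1⇒n≡1+m 2n≤gn (subst (λ v → ∣ v - g n ∣ ≡ 1) fn≡2n gap))
    where
    fn≡2n : f n ≡ 2 * n
    fn≡2n = subst (λ k → f k ≡ 2 * n) (index-of-2*n 2n≤fn fm≡2n) fm≡2n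

module Pairing (f g : ℕ → ℕ) (f-inc : StrictlyIncreasing f) (g-inc : StrictlyIncreasing g)
               (partition : RangesPartitionℕ f g) (gap : ∀ n → ∣ f n - g n ∣ ≡ 1) where

  paired : ∀ n → PairedAt f g n
  paired = <-rec (PairedAt f g) step
    where
    step : ∀ n → (∀ {k} → k < n → PairedAt f g k) → PairedAt f g n
    step n earlier =
      [ (λ (_ , fm≡2n) → value-2*n⇒even-odd f-inc earlier 2n≤fn 2n≤gn (gap n) fm≡2n)
      , (λ (_ , gm≡2n) → PairedAt-swap (value-2*n⇒even-odd g-inc earlier′ 2n≤gn 2n≤fn gap′ gm≡2n))
      ]′ (proj₁ partition (2 * n))
      where
      earlier′ : ∀ {k} → k < n → PairedAt g f k
      earlier′ = PairedAt-swap ∘ earlier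
      2n≤fn : 2 * n ≤ f n
      2n≤fn = 2*n≤f[n] f-inc earlier (proj₂ partition)
      2n≤gn : 2 * n ≤ g n
      2n≤gn = 2*n≤f[n] g-inc earlier′ (proj₂ (RangesPartitionℕ-swap partition))
      gap′ : ∣ g n - f n ∣ ≡ 1
      gap′ = trans (∣-∣-comm (g n) (f n)) (gap n)

agree-below⇒≤ : ∀ {f g n} → StrictlyIncreasing f → StrictlyIncreasing g →
                (∃ λ k → g k ≡ f n) → (∀ {m} → m < n → f m ≡ g m) → g n ≤ f n
agree-below⇒≤ {f} {g} {n} f-inc g-inc (k , gk≡fn) agree with <-cmp k n
... | tri< k<n _ _ = ⊥-elim (<-irrefl (trans (agree k<n) gk≡fn) (f-inc k n k<n))
... | tri≈ _ k≡n _ = ≤-reflexive (trans (cong g (sym k≡n)) gk≡fn)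
... | tri> _ _ n<k = ≤-trans (<⇒≤ (g-inc n k n<k)) (≤-reflexive gk≡fn)

sameRange⇒≗ : ∀ {f g} → StrictlyIncreasing f → StrictlyIncreasing g →
              (∀ n → ∃ λ k → g k ≡ f n) → (∀ n → ∃ λ k → f k ≡ g n) → ∀ n → f n ≡ g n
sameRange⇒≗ {f} {g} f-inc g-inc f⊆g g⊆f = <-rec (λ n → f n ≡ g n) λ n agree →
  ≤-antisym (agree-below⇒≤ g-inc f-inc (g⊆f n) (sym ∘ agree))
            (agree-below⇒≤ f-inc g-inc (f⊆g n) agree)

IsIncreasingEnumeration-unique : ∀ {f g P} →
  IsIncreasingEnumeration f P → IsIncreasingEnumeration g P → ∀ n → f n ≡ g n
IsIncreasingEnumeration-unique {f} {g} (f-inc , f-sound , f-complete) (g-inc , g-sound , g-complete) =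
  sameRange⇒≗ f-inc g-inc (λ n → g-complete (f n) (f-sound (f n) (n , refl)))
                          (λ n → f-complete (g n) (g-sound (g n) (n , refl)))

separating⇒IsIncreasingEnumeration : ∀ {f g : ℕ → ℕ} {P : ℕ → Set} → StrictlyIncreasing f →
  (∀ m → (∃ λ n → f n ≡ m) ⊎ (∃ λ n → g n ≡ m)) → (∀ n → P (f n)) → (∀ n → ¬ P (g n)) →
  IsIncreasingEnumeration f P
separating⇒IsIncreasingEnumeration {f} {g} {P} f-inc cover P-f ¬P-g =
  f-inc , (λ { m (n , fn≡m) → subst P fn≡m (P-f n) }) , complete
  where
  complete : ∀ m → P m → ∃ λ n → f n ≡ m
  complete m Pm =
    [ (λ in-f → in-f) , (λ { (n , gn≡m) → ⊥-elim (¬P-g n (subst P (sym gn≡m) Pm)) }) ]′ (cover m)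

[+m]-[+1+m]≡-1 : ∀ m → + m - + suc m ≡ - + 1
[+m]-[+1+m]≡-1 m = begin
  + m - + suc m      ≡⟨ [+m]-[+n]≡m⊖n m (suc m) ⟩
  m ℤ.⊖ suc m        ≡⟨ ⊖-< (n<1+n m) ⟩
  - + (suc m ∸ m)    ≡⟨ cong (-_ ∘ +_) (m+n∸n≡m 1 m) ⟩
  - + 1              ∎

[+1+m]-[+m]≡1 : ∀ m → + suc m - + m ≡ + 1
[+1+m]-[+m]≡1 m = begin
  + suc m - + m      ≡⟨ [+m]-[+n]≡m⊖n (suc m) m ⟩
  suc m ℤ.⊖ m        ≡⟨ ⊖-≥ (n≤1+n m) ⟩
  + (suc m ∸ m)      ≡⟨ cong +_ (m+n∸n≡m 1 m) ⟩
  + 1                ∎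

reverse-difference : ∀ (i j k l : ℤ) → i - j ≡ k - l → j - i ≡ l - k
reverse-difference i j k l eq = begin
  j - i        ≡⟨ ⁻¹-anti-homo‿- i j ⟨
  - (i - j)    ≡⟨ cong -_ eq ⟩
  - (k - l)    ≡⟨ ⁻¹-anti-homo‿- k l ⟩
  l - k        ∎

module Classification (f g : ℕ → ℕ) (f-inc : StrictlyIncreasing f) (g-inc : StrictlyIncreasing g)
                      (partition : RangesPartitionℕ f g) (gap : ∀ n → ∣ f n - g n ∣ ≡ 1)
                      (ff : ∀ n → f (f n) ≡ 2 * f n) (gg : ∀ n → g (g n) ≡ 2 * g n)
                      (f0≡0 : f 0 ≡ 0) where

  open Pairing f g f-inc g-inc partition gap

  EvilOdiousAt : ℕ → Set
  EvilOdiousAt m = Evil (f m) × Odious (g m)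

  EvilOdiousAt-f : ∀ q → Evil (f q) → EvilOdiousAt (f q)
  EvilOdiousAt-f q evil =
    subst Evil (sym (ff q)) (trans (thueMorse-double (f q)) evil) ,
    subst Odious (sym (PairedAt-partner (paired (f q)) (ff q))) (Evil⇒Odious-suc-double (f q) evil)

  EvilOdiousAt-g : ∀ q → Odious (g q) → EvilOdiousAt (g q)
  EvilOdiousAt-g q odious =
    subst Evil (sym (PairedAt-partner (PairedAt-swap (paired (g q))) (gg q)))
               (Odious⇒Evil-suc-double (g q) odious) ,
    subst Odious (sym (gg q)) (trans (thueMorse-double (g q)) odious)

  evil-odious : ∀ n → EvilOdiousAt n
  evil-odious = <-rec EvilOdiousAt step
    where
    step : ∀ n → (∀ {k} → k < n → EvilOdiousAt k) → EvilOdiousAt n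
    step zero _ =
      subst Evil (sym f0≡0) refl , subst Odious (sym (PairedAt-partner (paired 0) f0≡0)) refl
    step (suc m) earlier with proj₁ partition (suc m)
    ... | inj₁ (q , fq≡1+m) =
      subst EvilOdiousAt fq≡1+m (EvilOdiousAt-f q (proj₁ (earlier (index<value (paired q) fq≡1+m))))
    ... | inj₂ (q , gq≡1+m) =
      subst EvilOdiousAt gq≡1+m
            (EvilOdiousAt-g q (proj₂ (earlier (index<value (PairedAt-swap (paired q)) gq≡1+m))))

  f-enumerates-Evil : IsIncreasingEnumeration f Evil
  f-enumerates-Evil = separating⇒IsIncreasingEnumeration f-inc (proj₁ partition)
    (proj₁ ∘ evil-odious) (λ n evil → Evil⇒¬Odious (g n) evil (proj₂ (evil-odious n)))

  g-enumerates-Odious : IsIncreasingEnumeration g Odious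
  g-enumerates-Odious =
    separating⇒IsIncreasingEnumeration g-inc (proj₁ (RangesPartitionℕ-swap partition))
    (proj₂ ∘ evil-odious) (λ n odious → Evil⇒¬Odious (f n) (proj₁ (evil-odious n)) odious)

  difference : ∀ n → + f n - + g n ≡ + 2 ℤ.* + thueMorse n - + 1
  difference n with paired n
  ... | even-odd fn≡2n gn≡1+2n = begin
    + f n - + g n                 ≡⟨ cong₂ (λ a b → + a - + b) fn≡2n gn≡1+2n ⟩
    + (2 * n) - + suc (2 * n)     ≡⟨ [+m]-[+1+m]≡-1 (2 * n) ⟩
    + 2 ℤ.* + 0 - + 1             ≡⟨ cong (λ t → + 2 ℤ.* + t - + 1) tn≡0 ⟨
    + 2 ℤ.* + thueMorse n - + 1   ∎
    where
    tn≡0 : thueMorse n ≡ 0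
    tn≡0 = trans (sym (thueMorse-double n)) (subst Evil fn≡2n (proj₁ (evil-odious n)))
  ... | odd-even gn≡2n fn≡1+2n = begin
    + f n - + g n                 ≡⟨ cong₂ (λ a b → + a - + b) fn≡1+2n gn≡2n ⟩
    + suc (2 * n) - + (2 * n)     ≡⟨ [+1+m]-[+m]≡1 (2 * n) ⟩
    + 2 ℤ.* + 1 - + 1             ≡⟨ cong (λ t → + 2 ℤ.* + t - + 1) tn≡1 ⟨
    + 2 ℤ.* + thueMorse n - + 1   ∎
    where
    tn≡1 : thueMorse n ≡ 1
    tn≡1 = trans (sym (thueMorse-double n)) (subst Odious gn≡2n (proj₂ (evil-odious n)))

theorem5p2 : (x y : ℕ → ℕ) →
    StrictlyIncreasing x → StrictlyIncreasing y → RangesPartitionℕ x y →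
    (∀ n → x (x n) ≡ 2 * x n) → (∀ n → y (y n) ≡ 2 * y n) → (∀ n → ∣ x n - y n ∣ ≡ 1) →
    (∀ (a b : ℕ → ℕ) → IsIncreasingEnumeration a Odious → IsIncreasingEnumeration b Evil →
      ((∀ n → x n ≡ a n) × (∀ n → y n ≡ b n)) ⊎ ((∀ n → x n ≡ b n) × (∀ n → y n ≡ a n)))
    × ((∀ n → (+ x n) - (+ y n) ≡ + 1 - (+ 2) ℤ.* (+ thueMorse n))
       ⊎ (∀ n → (+ x n) - (+ y n) ≡ (+ 2) ℤ.* (+ thueMorse n) - + 1))
theorem5p2 x y x-inc y-inc partition xx yy gap with Pairing.paired x y x-inc y-inc partition gap 0
... | even-odd x0≡0 _ =
  (λ a b a-odious b-evil → inj₂ ( IsIncreasingEnumeration-unique X.f-enumerates-Evil b-evil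
                                , IsIncreasingEnumeration-unique X.g-enumerates-Odious a-odious)) ,
  inj₂ X.difference
  where module X = Classification x y x-inc y-inc partition gap xx yy x0≡0
... | odd-even y0≡0 _ =
  (λ a b a-odious b-evil → inj₁ ( IsIncreasingEnumeration-unique Y.g-enumerates-Odious a-odious
                                , IsIncreasingEnumeration-unique Y.f-enumerates-Evil b-evil)) ,
  inj₁ λ n → reverse-difference (+ y n) (+ x n) (+ 2 ℤ.* + thueMorse n) (+ 1) (Y.difference n)
  where
  module Y = Classification y x y-inc x-inc (RangesPartitionℕ-swap partition)
                            (λ n → trans (∣-∣-comm (y n) (x n)) (gap n)) yy xx y0≡0
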